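{- Let $n \geq 2$ be an integer, let $T_n$ be the butterfly poset of rank $n$, and let $\tau : W(T_n) \to \{\mathbf{a},\mathbf{b}\}$ be a function such that in every interval $[x,y]$ of $T_n$ of rank $3$ or less with $x<y$ there is a unique rising chain. Then: (i) there is a breakpoint $y$ in $T_n$; and (ii) $\tau$ is a triple assignment of $T_n$.
   Context: The butterfly poset $T_n$ is the unique graded poset of rank $n$ (with minimum $\hat 0$ of rank $0$ and maximum $\hat 1$ of rank $n$) having exactly two elements of rank $i$ for each $1 \leq i \leq n-1$, and in which every element other than $\hat{0}$ covers all elements of rank one less than its own rank. For a poset $P$, $x \prec y$ means $y$ covers $x$, and $W(P) = \{(x,y,z) \in P^3 : x \prec y \prec z\}$. Given $\tau : W(P) \to \{\mathbf{a},\mathbf{b}\}$, a rising chain in an interval $[x,y]$ is a maximal chain $x = x_0 \prec x_1 \prec \cdots \prec x_k = y$ with $\tau(x_i,x_{i+1},x_{i+2}) = \mathbf{a}$ for all $0 \le i \le k-2$. The function $\tau$ is a triple assignment of $P$ if every interval $[x,y]$ with $x<y$ has a unique rising chain. An element $y$ of $T_n$ is a breakpoint (for $\tau$) if $\hat 0 < y < \hat 1$ and the value $\tau(x,y,z)$ (over all $x,z$ with $x \prec y \prec z$) does not depend on $x$ and $z$. -}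

module Defs where

open import Data.Nat using (ℕ; zero; suc; _∸_; _≤_; _<_)
open import Data.Fin using (Fin; toℕ)
open import Data.Bool using (Bool)
open import Data.Product using (Σ; _×_; _,_)
open import Data.Unit using (⊤)
open import Relation.Binary.PropositionalEquality using (_≡_)

data AB : Set where
  𝐚 𝐛 : AB

-- Elements of the butterfly poset T_n:
--   bot      = 0̂ (rank 0)
--   mid i s  = one of the two elements of rank (toℕ i + 1), 1 ≤ rank ≤ n-1,
--              s : Bool selects which of the two
--   top      = 1̂ (rank n)
data T (n : ℕ) : Set where
  bot : T n
  mid : Fin (n ∸ 1) → Bool → T n
  top : T n

rank : ∀ {n} → T n → ℕ
rank bot       = 0
rank (mid i s) = suc (toℕ i)
rank {n} top   = n

_≺_ : ∀ {n} → T n → T n → Set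
x ≺ y = rank y ≡ suc (rank x)

-- Strict order of T_n: x < y iff rank x < rank y (the transitive closure of ≺).
_⊏_ : ∀ {n} → T n → T n → Set
x ⊏ y = rank x < rank y

-- τ : W(T_n) → {a,b}, W = covering triples x ≺ y ≺ z
Assignment : ℕ → Set
Assignment n = (x y z : T n) → x ≺ y → y ≺ z → AB

data Chain {n : ℕ} : T n → T n → Set where
  done : (x : T n) → Chain x x
  step : {x y z : T n} → x ≺ y → Chain y z → Chain x z

Rising : ∀ {n} → Assignment n → {x z : T n} → Chain x z → Set
Rising τ (done _) = ⊤
Rising τ (step p (done _)) = ⊤
Rising τ (step {x} {y} p (step {.y} {w} q c)) =
  (τ x y w p q ≡ 𝐚) × Rising τ (step q c)

UniqueRising : ∀ {n} → Assignment n → T n → T n → Set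
UniqueRising τ x y =
  Σ (Chain x y) λ c → Rising τ c × ((c′ : Chain x y) → Rising τ c′ → c′ ≡ c)

IsTripleAssignment : ∀ {n} → Assignment n → Set
IsTripleAssignment {n} τ = (x y : T n) → x ⊏ y → UniqueRising τ x y

IsBreakpoint : ∀ {n} → Assignment n → T n → Set
IsBreakpoint {n} τ y =
  (bot ⊏ y) × (y ⊏ top) ×
  ((x z x′ z′ : T n) (p : x ≺ y) (q : y ≺ z) (p′ : x′ ≺ y) (q′ : y ≺ z′) →
     τ x y z p q ≡ τ x′ y z′ p′ q′)

module Submission where

-- In a rank-two interval [x,z] the two maximal chains pass through y and its partner y′ (the other
-- element of rank y), so a unique rising chain forces τ(x,y′,z) to be the opposite label of
-- τ(x,y,z).  Given this, the four maximal chains of a rank-three interval x ≺ y ≺ z ≺ w come in two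
-- antipodal pairs with equal labels unless τ(x,y,z) = τ(x,y,z′) or τ(y,z,w) = τ(y′,z,w).
--
-- Breakpoint: call y left-independent when τ(x,y,z) does not depend on x; rank-one elements are.
-- Going up, a left-independent Y ≺ y is a breakpoint unless τ(x,Y,y) ≠ τ(x,Y,y′), and then the
-- second alternative above makes y left-independent.  An element of rank n − 1 has 1̂ as its only
-- upper cover, so left-independence makes it a breakpoint.
--
-- Triple assignment: fix the top v and induct on the length of [u,v].  Along with uniqueness one
-- carries the fact that the first label τ(u,y,·) of the rising chain u ≺ y ≺ ⋯ is 𝐚 also at the
-- rising successor of the partner of y; the rank-three dichotomy then shows that τ(u,y,·) takes
-- the same value at the rising successors of both covers of u, so exactly one of the two covers
-- of u starts a rising chain of [u,v].

open import Defs
open import Data.Nat using (ℕ; zero; suc; s≤s⁻¹; _+_; _∸_; _≤_; z≤n; s≤s; _≟_; _<?_)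
open import Data.Nat.Properties
  using (≡-irrelevant; +-suc; +-cancelʳ-≡; m≢1+n+m; m≤n+m; m+n∸n≡m; m∸n+n≡m;
         <-irrefl; <⇒≤; ≤-trans; ≤-refl; ≤-antisym; ≮⇒≥; n≤1+n; suc-injective)
open import Data.Fin using (Fin; fromℕ<)
open import Data.Fin.Properties using (toℕ<n; toℕ-fromℕ<; toℕ-injective)
open import Data.Bool using (Bool; true; false; not)
open import Data.Product using (Σ; _×_; _,_; proj₁; proj₂)
open import Data.Sum using (_⊎_; inj₁; inj₂)
open import Data.Unit using (tt)
open import Data.Empty using (⊥-elim)
open import Relation.Nullary using (¬_; yes; no)
open import Relation.Binary.Definitions using (DecidableEquality)
open import Relation.Binary.PropositionalEquality
  using (_≡_; _≢_; refl; sym; trans; cong; cong₂; subst; module ≡-Reasoning)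

open ≡-Reasoning

opp : AB → AB
opp 𝐚 = 𝐛
opp 𝐛 = 𝐚

𝐚≢𝐛 : 𝐚 ≢ 𝐛
𝐚≢𝐛 ()

_≟ᴬᴮ_ : DecidableEquality AB
𝐚 ≟ᴬᴮ 𝐚 = yes refl
𝐚 ≟ᴬᴮ 𝐛 = no λ ()
𝐛 ≟ᴬᴮ 𝐚 = no λ ()
𝐛 ≟ᴬᴮ 𝐛 = yes refl

Both : AB → AB → Set
Both s t = s ≡ 𝐚 × t ≡ 𝐚

exactly-one⇒opp : ∀ s t → s ≡ 𝐚 ⊎ t ≡ 𝐚 → ¬ Both s t → t ≡ opp s
exactly-one⇒opp 𝐚 𝐚 _          ¬both = ⊥-elim (¬both (refl , refl))
exactly-one⇒opp 𝐚 𝐛 _          _     = refl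
exactly-one⇒opp 𝐛 𝐚 _          _     = refl
exactly-one⇒opp 𝐛 𝐛 (inj₁ ()) _
exactly-one⇒opp 𝐛 𝐛 (inj₂ ()) _

-- The four pairs are the labels of the four maximal chains of a rank-three interval
-- x ≺ {y, y′} ≺ {z, z′} ≺ w, with P = τ(x,y,z), Q = τ(x,y,z′), R = τ(y,z,w), S = τ(y′,z,w).
one-of-four⇒ : ∀ P Q R S →
  Both P R ⊎ Both Q (opp R) ⊎ Both (opp P) S ⊎ Both (opp Q) (opp S) →
  ¬ (Both P R × Both (opp Q) (opp S)) →
  ¬ (Both Q (opp R) × Both (opp P) S) →
  P ≡ Q ⊎ R ≡ S
one-of-four⇒ 𝐚 𝐚 _ _ _ _ _ = inj₁ refl
one-of-four⇒ 𝐛 𝐛 _ _ _ _ _ = inj₁ refl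
one-of-four⇒ _ _ 𝐚 𝐚 _ _ _ = inj₂ refl
one-of-four⇒ _ _ 𝐛 𝐛 _ _ _ = inj₂ refl
one-of-four⇒ 𝐚 𝐛 𝐚 𝐛 _ ¬both _ = ⊥-elim (¬both ((refl , refl) , (refl , refl)))
one-of-four⇒ 𝐛 𝐚 𝐛 𝐚 _ _ ¬both = ⊥-elim (¬both ((refl , refl) , (refl , refl)))
one-of-four⇒ 𝐚 𝐛 𝐛 𝐚 (inj₁ (_ , ()))                 _ _
one-of-four⇒ 𝐚 𝐛 𝐛 𝐚 (inj₂ (inj₁ (() , _)))          _ _
one-of-four⇒ 𝐚 𝐛 𝐛 𝐚 (inj₂ (inj₂ (inj₁ (() , _))))   _ _
one-of-four⇒ 𝐚 𝐛 𝐛 𝐚 (inj₂ (inj₂ (inj₂ (_ , ()))))   _ _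
one-of-four⇒ 𝐛 𝐚 𝐚 𝐛 (inj₁ (() , _))                 _ _
one-of-four⇒ 𝐛 𝐚 𝐚 𝐛 (inj₂ (inj₁ (_ , ())))          _ _
one-of-four⇒ 𝐛 𝐚 𝐚 𝐛 (inj₂ (inj₂ (inj₁ (_ , ()))))   _ _
one-of-four⇒ 𝐛 𝐚 𝐚 𝐛 (inj₂ (inj₂ (inj₂ (() , _))))   _ _

⊏-from-distance : ∀ {n k} {x z : T n} → rank z ≡ suc k + rank x → x ⊏ z
⊏-from-distance {k = k} {x} e = subst (suc (rank x) ≤_) (sym e) (s≤s (m≤n+m (rank x) k))

distance-≺ : ∀ {n k} {u y v : T n} → rank v ≡ suc k + rank u → u ≺ y → rank v ≡ k + rank y
distance-≺ {k = k} {u} e p = trans e (trans (sym (+-suc k (rank u))) (cong (k +_) (sym p)))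

distance-from-⊏ : ∀ {n} {x z : T n} → x ⊏ z → rank z ≡ suc (rank z ∸ suc (rank x)) + rank x
distance-from-⊏ {x = x} {z} x⊏z =
  sym (trans (sym (+-suc (rank z ∸ suc (rank x)) (rank x))) (m∸n+n≡m x⊏z))

∸-from-distance : ∀ {n k} {x z : T n} → rank z ≡ k + rank x → rank z ∸ rank x ≡ k
∸-from-distance {k = k} {x} e = trans (cong (_∸ rank x) e) (m+n∸n≡m k (rank x))

length : ∀ {n} {x z : T n} → Chain x z → ℕ
length (done _)   = 0
length (step _ c) = suc (length c)

-- the element x₁ of a chain x = x₀ ≺ x₁ ≺ ⋯; junk value x for the empty chain
next : ∀ {n} {x z : T n} → Chain x z → T n
next (done x)           = x
next (step {y = y} _ _) = y

rank-end : ∀ {n} {x z : T n} (c : Chain x z) → rank z ≡ length c + rank x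
rank-end (done _) = refl
rank-end {x = x} (step p c) =
  trans (rank-end c) (trans (cong (length c +_) p) (+-suc (length c) (rank x)))

length-from-rank : ∀ {n} {x z : T n} (c : Chain x z) (k : ℕ) → rank z ≡ k + rank x → length c ≡ k
length-from-rank {x = x} c k e = +-cancelʳ-≡ (rank x) (length c) k (trans (sym (rank-end c)) e)

≺-next : ∀ {n} {x z : T n} (c : Chain x z) → x ⊏ z → x ≺ next c
≺-next (done _)   x⊏x = ⊥-elim (<-irrefl refl x⊏x)
≺-next (step p _) _   = p

next-of-cover : ∀ {n} {x z : T n} (c : Chain x z) → x ≺ z → next c ≡ z
next-of-cover {n} {x} {z} c p = go c (length-from-rank c 1 p)
  where
  go : (c : Chain x z) → length c ≡ 1 → next c ≡ z
  go (step _ (done _))     _ = refl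
  go (done _)              ()
  go (step _ (step _ _))   ()

chain-of-length-2 : ∀ {n} {x z : T n} (c : Chain x z) → length c ≡ 2 →
  Σ (T n) λ y → Σ (x ≺ y) λ p → Σ (y ≺ z) λ q → c ≡ step p (step q (done z))
chain-of-length-2 (step p (step q (done _))) _ = _ , p , q , refl
chain-of-length-2 (done _)                   ()
chain-of-length-2 (step _ (done _))          ()
chain-of-length-2 (step _ (step _ (step _ _))) ()

chain-of-length-3 : ∀ {n} {x w : T n} (c : Chain x w) → length c ≡ 3 →
  Σ (T n) λ y → Σ (T n) λ z → Σ (x ≺ y) λ p → Σ (y ≺ z) λ q → Σ (z ≺ w) λ r →
    c ≡ step p (step q (step r (done w)))
chain-of-length-3 (step p (step q (step r (done _)))) _ = _ , _ , p , q , r , refl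
chain-of-length-3 (done _)                            ()
chain-of-length-3 (step _ (done _))                   ()
chain-of-length-3 (step _ (step _ (done _)))          ()
chain-of-length-3 (step _ (step _ (step _ (step _ _)))) ()

partner : ∀ {n} → T n → T n
partner bot       = bot
partner (mid i s) = mid i (not s)
partner top       = top

rank-partner : ∀ {n} (y : T n) → rank (partner y) ≡ rank y
rank-partner bot       = refl
rank-partner (mid i s) = refl
rank-partner top       = refl

≺-respects-rankˡ : ∀ {n} {x x′ y : T n} → rank x ≡ rank x′ → x ≺ y → x′ ≺ y
≺-respects-rankˡ e p = trans p (cong suc e)

≺-partnerˡ : ∀ {n} {x y : T n} → x ≺ y → partner x ≺ y
≺-partnerˡ {x = x} p = trans p (cong suc (sym (rank-partner x)))

≺-partnerʳ : ∀ {n} {x y : T n} → x ≺ y → x ≺ partner y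
≺-partnerʳ {y = y} p = trans (rank-partner y) p

mid⊏top : ∀ n (i : Fin (n ∸ 1)) (s : Bool) → _⊏_ {n} (mid i s) top
mid⊏top (suc n) i s = s≤s (toℕ<n i)

rank≤n : ∀ {n} (y : T n) → rank y ≤ n
rank≤n bot       = z≤n
rank≤n {n} (mid i s) = <⇒≤ (mid⊏top n i s)
rank≤n top       = ≤-refl

≺⇒⊏top : ∀ {n} {x y : T n} → x ≺ y → x ⊏ top
≺⇒⊏top {y = y} p = subst (_≤ _) p (rank≤n y)

≺⇒bot⊏ : ∀ {n} {x y : T n} → x ≺ y → bot ⊏ y
≺⇒bot⊏ p = subst (1 ≤_) (sym p) (s≤s z≤n)

rank≡0⇒bot : ∀ {n} {x : T n} → x ⊏ top → rank x ≡ 0 → x ≡ bot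
rank≡0⇒bot {x = bot} _     _ = refl
rank≡0⇒bot {x = top} x⊏top _ = ⊥-elim (<-irrefl refl x⊏top)

rank≡n⇒top : ∀ {n} {x : T n} → bot ⊏ x → rank x ≡ n → x ≡ top
rank≡n⇒top {x = bot}     bot⊏x _ = ⊥-elim (<-irrefl refl bot⊏x)
rank≡n⇒top {n} {x = mid i s} _ e = ⊥-elim (<-irrefl e (mid⊏top n i s))
rank≡n⇒top {x = top}     _     _ = refl

≡⊎≡partner : ∀ {n} {y x : T n} → bot ⊏ y → rank x ≡ rank y → x ≡ y ⊎ x ≡ partner y
≡⊎≡partner {y = bot} bot⊏bot _ = ⊥-elim (<-irrefl refl bot⊏bot)
≡⊎≡partner {y = top} {bot} bot⊏top e = ⊥-elim (<-irrefl e bot⊏top)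
≡⊎≡partner {n} {y = top} {mid i s} _ e = ⊥-elim (<-irrefl e (mid⊏top n i s))
≡⊎≡partner {y = top} {top} _ _ = inj₁ refl
≡⊎≡partner {y = mid i s} {bot} _ ()
≡⊎≡partner {n} {y = mid i s} {top} _ e = ⊥-elim (<-irrefl (sym e) (mid⊏top n i s))
≡⊎≡partner {y = mid i s} {mid j t} _ e with toℕ-injective (suc-injective e)
≡⊎≡partner {y = mid i true}  {mid .i true}  _ _ | refl = inj₁ refl
≡⊎≡partner {y = mid i true}  {mid .i false} _ _ | refl = inj₂ refl
≡⊎≡partner {y = mid i false} {mid .i true}  _ _ | refl = inj₂ refl
≡⊎≡partner {y = mid i false} {mid .i false} _ _ | refl = inj₁ refl

≡⊎≡partner-above : ∀ {n} {x y x′ : T n} → x ≺ y → rank x′ ≡ rank y → x′ ≡ y ⊎ x′ ≡ partner y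
≡⊎≡partner-above {x = x} p = ≡⊎≡partner (≺⇒bot⊏ {x = x} p)

partner-≢ : ∀ {n} {y : T n} → bot ⊏ y → y ⊏ top → partner y ≢ y
partner-≢ {y = bot}         bot⊏bot _ _ = <-irrefl refl bot⊏bot
partner-≢ {y = top}         _ top⊏top _ = <-irrefl refl top⊏top
partner-≢ {y = mid i true}  _ _ ()
partner-≢ {y = mid i false} _ _ ()

partner-≢-between : ∀ {n} {x y z : T n} → x ≺ y → y ≺ z → partner y ≢ y
partner-≢-between {x = x} {z = z} p q = partner-≢ (≺⇒bot⊏ {x = x} p) (≺⇒⊏top {y = z} q)

element-of-rank : ∀ {n} (r : ℕ) → r ≤ n → Σ (T n) λ y → rank y ≡ r
element-of-rank zero    _ = bot , refl
element-of-rank {n = suc n} (suc r) r<n with r <? n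
... | yes r<n′ = mid (fromℕ< r<n′) true , cong suc (toℕ-fromℕ< r<n′)
... | no  r≮n  = top , cong suc (≤-antisym (≮⇒≥ r≮n) (s≤s⁻¹ r<n))

cover-of : ∀ {n} {x : T n} → x ⊏ top → Σ (T n) (x ≺_)
cover-of {x = x} = element-of-rank (suc (rank x))

lower-cover : ∀ {n k} {y : T n} → rank y ≡ suc k → Σ (T n) λ x → rank x ≡ k × x ≺ y
lower-cover {k = k} {y} e with element-of-rank k (≤-trans (n≤1+n k) (subst (_≤ _) e (rank≤n y)))
... | x , ex = x , ex , trans e (cong suc (sym ex))

LocallyTriple : ∀ {n} → Assignment n → Set
LocallyTriple {n} τ = (x y : T n) → x ⊏ y → rank y ∸ rank x ≤ 3 → UniqueRising τ x y

rising-unique : ∀ {n} {τ : Assignment n} {x z : T n} → UniqueRising τ x z →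
  (c c′ : Chain x z) → Rising τ c → Rising τ c′ → c′ ≡ c
rising-unique (_ , _ , unique) c c′ r r′ = trans (unique c′ r′) (sym (unique c r))

rising-next-unique : ∀ {n} {τ : Assignment n} {x z : T n} → UniqueRising τ x z →
  (c c′ : Chain x z) → Rising τ c → Rising τ c′ → next c ≡ next c′
rising-next-unique U c c′ r r′ = cong next (sym (rising-unique U c c′ r r′))

rising-tail : ∀ {n} {τ : Assignment n} {x y z : T n} (p : x ≺ y) (c : Chain y z) →
  Rising τ (step p c) → Rising τ c
rising-tail p (done _)   _ = tt
rising-tail p (step _ _) r = proj₂ r

module _ {n : ℕ} (τ : Assignment n) where

  -- τ with the covering proofs decided, so that labels can be stated without them
  τ̂ : T n → T n → T n → AB
  τ̂ x y z with rank y ≟ suc (rank x) | rank z ≟ suc (rank y)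
  ... | yes p | yes q = τ x y z p q
  ... | _     | _     = 𝐚

  τ≡τ̂ : ∀ {x y z} (p : x ≺ y) (q : y ≺ z) → τ x y z p q ≡ τ̂ x y z
  τ≡τ̂ {x} {y} {z} p q with rank y ≟ suc (rank x) | rank z ≟ suc (rank y)
  ... | yes p′ | yes q′ = cong₂ (τ x y z) (≡-irrelevant p p′) (≡-irrelevant q q′)
  ... | no ¬p  | _      = ⊥-elim (¬p p)
  ... | yes _  | no ¬q  = ⊥-elim (¬q q)

  rising-head : ∀ {x y z} (p : x ≺ y) (c : Chain y z) → y ⊏ z →
    Rising τ (step p c) → τ̂ x y (next c) ≡ 𝐚
  rising-head p (done _)   y⊏y _ = ⊥-elim (<-irrefl refl y⊏y)
  rising-head p (step q _) _   r = trans (sym (τ≡τ̂ p q)) (proj₁ r)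

  rising-cons : ∀ {x y z} (p : x ≺ y) (c : Chain y z) → y ⊏ z →
    τ̂ x y (next c) ≡ 𝐚 → Rising τ c → Rising τ (step p c)
  rising-cons p (done _)   y⊏y _ _ = ⊥-elim (<-irrefl refl y⊏y)
  rising-cons p (step q _) _   h r = trans (τ≡τ̂ p q) h , r

  rising₂ : ∀ {x y z} (p : x ≺ y) (q : y ≺ z) →
    τ̂ x y z ≡ 𝐚 → Rising τ (step p (step q (done z)))
  rising₂ p q h = trans (τ≡τ̂ p q) h , tt

  rising₂⁻¹ : ∀ {x y z} (p : x ≺ y) (q : y ≺ z) →
    Rising τ (step p (step q (done z))) → τ̂ x y z ≡ 𝐚
  rising₂⁻¹ p q (h , _) = trans (sym (τ≡τ̂ p q)) h

  rising₃ : ∀ {x y z w} (p : x ≺ y) (q : y ≺ z) (r : z ≺ w) →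
    Both (τ̂ x y z) (τ̂ y z w) → Rising τ (step p (step q (step r (done w))))
  rising₃ p q r (h , h′) = trans (τ≡τ̂ p q) h , trans (τ≡τ̂ q r) h′ , tt

  rising₃⁻¹ : ∀ {x y z w} (p : x ≺ y) (q : y ≺ z) (r : z ≺ w) →
    Rising τ (step p (step q (step r (done w)))) → Both (τ̂ x y z) (τ̂ y z w)
  rising₃⁻¹ p q r (h , h′ , _) = trans (sym (τ≡τ̂ p q)) h , trans (sym (τ≡τ̂ q r)) h′

  LeftIndependent : T n → Set
  LeftIndependent y = ∀ {x x′ z} → x ≺ y → x′ ≺ y → y ≺ z → τ̂ x y z ≡ τ̂ x′ y z

  RightIndependent : T n → Set
  RightIndependent y = ∀ {x z z′} → x ≺ y → y ≺ z → y ≺ z′ → τ̂ x y z ≡ τ̂ x y z′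

  breakpoint-intro : ∀ {y} → bot ⊏ y → y ⊏ top →
    LeftIndependent y → RightIndependent y → IsBreakpoint τ y
  breakpoint-intro {y} bot⊏y y⊏top left right = bot⊏y , y⊏top , λ x z x′ z′ p q p′ q′ → begin
    τ x y z p q      ≡⟨ τ≡τ̂ p q ⟩
    τ̂ x y z          ≡⟨ right p q q′ ⟩
    τ̂ x y z′         ≡⟨ left p p′ q′ ⟩
    τ̂ x′ y z′        ≡⟨ sym (τ≡τ̂ p′ q′) ⟩
    τ x′ y z′ p′ q′  ∎

  left-independent-rank-one : ∀ {y} → rank y ≡ 1 → LeftIndependent y
  left-independent-rank-one {y} e {x} {x′} {z} p p′ _ =
    cong (λ x → τ̂ x y z) (trans (≡bot p) (sym (≡bot p′)))
    where
    ≡bot : ∀ {x} → x ≺ y → x ≡ bot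
    ≡bot {x} p = rank≡0⇒bot (≺⇒⊏top {x = x} p) (suc-injective (trans (sym p) e))

  right-independent-below-top : ∀ {y} → y ≺ top → RightIndependent y
  right-independent-below-top {y} y≺top {x} {z} {z′} _ q q′ =
    cong (τ̂ x y) (trans (≡top q) (sym (≡top q′)))
    where
    ≡top : ∀ {z} → y ≺ z → z ≡ top
    ≡top {z} q = rank≡n⇒top (≺⇒bot⊏ {x = y} q) (trans q (sym y≺top))

  module _ (local : LocallyTriple τ) where

    unique-rising-local : ∀ {x z} k → rank z ≡ suc k + rank x → suc k ≤ 3 → UniqueRising τ x z
    unique-rising-local {x} {z} k e k<3 =
      local x z (⊏-from-distance {x = x} {z} e)
        (subst (_≤ 3) (sym (∸-from-distance {x = x} {z} e)) k<3)

    τ̂-partner-middle : ∀ {x y z} → x ≺ y → y ≺ z → τ̂ x (partner y) z ≡ opp (τ̂ x y z)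
    τ̂-partner-middle {x} {y} {z} p q = exactly-one⇒opp _ _ some-rising not-both
      where
      e : rank z ≡ 2 + rank x
      e = trans q (cong suc p)
      unique : UniqueRising τ x z
      unique = unique-rising-local 1 e (s≤s (s≤s z≤n))
      p′ : x ≺ partner y
      p′ = ≺-partnerʳ {y = y} p
      q′ : partner y ≺ z
      q′ = ≺-partnerˡ {x = y} q
      some-rising : τ̂ x y z ≡ 𝐚 ⊎ τ̂ x (partner y) z ≡ 𝐚
      some-rising with chain-of-length-2 (proj₁ unique) (length-from-rank (proj₁ unique) 2 e)
      ... | w , pw , qw , c≡ with ≡⊎≡partner-above {x = x} {y} {w} p (trans pw (sym p))
      ... | inj₁ refl = inj₁ (rising₂⁻¹ pw qw (subst (Rising τ) c≡ (proj₁ (proj₂ unique))))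
      ... | inj₂ refl = inj₂ (rising₂⁻¹ pw qw (subst (Rising τ) c≡ (proj₁ (proj₂ unique))))
      not-both : ¬ Both (τ̂ x y z) (τ̂ x (partner y) z)
      not-both (h , h′) = partner-≢-between {x = x} {y} {z} p q
        (rising-next-unique unique (step p′ (step q′ (done z))) (step p (step q (done z)))
          (rising₂ p′ q′ h′) (rising₂ p q h))

    rank-three : ∀ {x y z w} → x ≺ y → y ≺ z → z ≺ w →
      τ̂ x y z ≡ τ̂ x y (partner z) ⊎ τ̂ y z w ≡ τ̂ (partner y) z w
    rank-three {x} {y} {z} {w} p q r =
      one-of-four⇒ _ _ _ _ some-rising
        (λ (hPR , hQ , hS) → not-both q r q₃ r′ (hPR , trans opp-Q hQ , trans opp-S hS))
        (λ ((hQ , hR) , hP , hS) → not-both q₁ r′ q₂ r ((hQ , trans opp-R hR) , trans opp-P hP , hS))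
      where
      e : rank w ≡ 3 + rank x
      e = trans r (cong suc (trans q (cong suc p)))
      unique : UniqueRising τ x w
      unique = unique-rising-local 2 e (s≤s (s≤s (s≤s z≤n)))
      p′ : x ≺ partner y
      p′ = ≺-partnerʳ {y = y} p
      q₁ : y ≺ partner z
      q₁ = ≺-partnerʳ {y = z} q
      q₂ : partner y ≺ z
      q₂ = ≺-partnerˡ {x = y} q
      q₃ : partner y ≺ partner z
      q₃ = ≺-partnerˡ {x = y} q₁
      r′ : partner z ≺ w
      r′ = ≺-partnerˡ {x = z} r
      opp-P : τ̂ x (partner y) z ≡ opp (τ̂ x y z)
      opp-P = τ̂-partner-middle p q
      opp-Q : τ̂ x (partner y) (partner z) ≡ opp (τ̂ x y (partner z))
      opp-Q = τ̂-partner-middle p q₁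
      opp-R : τ̂ y (partner z) w ≡ opp (τ̂ y z w)
      opp-R = τ̂-partner-middle q r
      opp-S : τ̂ (partner y) (partner z) w ≡ opp (τ̂ (partner y) z w)
      opp-S = τ̂-partner-middle q₂ r
      not-both : ∀ {z₁ z₂} (q₁ : y ≺ z₁) (r₁ : z₁ ≺ w) (q₂ : partner y ≺ z₂) (r₂ : z₂ ≺ w) →
        ¬ (Both (τ̂ x y z₁) (τ̂ y z₁ w) × Both (τ̂ x (partner y) z₂) (τ̂ (partner y) z₂ w))
      not-both q₁ r₁ q₂ r₂ (h₁ , h₂) = partner-≢-between {x = x} {y} {z} p q
        (rising-next-unique unique (step p′ (step q₂ (step r₂ (done w))))
          (step p (step q₁ (step r₁ (done w)))) (rising₃ p′ q₂ r₂ h₂) (rising₃ p q₁ r₁ h₁))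
      some-rising :
        Both (τ̂ x y z) (τ̂ y z w) ⊎ Both (τ̂ x y (partner z)) (opp (τ̂ y z w)) ⊎
        Both (opp (τ̂ x y z)) (τ̂ (partner y) z w) ⊎
        Both (opp (τ̂ x y (partner z))) (opp (τ̂ (partner y) z w))
      some-rising with chain-of-length-3 (proj₁ unique) (length-from-rank (proj₁ unique) 3 e)
      ... | y₁ , z₁ , p₁ , q₁ , r₁ , c≡
        with rising₃⁻¹ p₁ q₁ r₁ (subst (Rising τ) c≡ (proj₁ (proj₂ unique)))
           | ≡⊎≡partner-above {x = x} {y} {y₁} p (trans p₁ (sym p))
           | ≡⊎≡partner-above {x = y} {z} {z₁} q (suc-injective (trans (sym r₁) r))
      ... | h , h′ | inj₁ refl | inj₁ refl = inj₁ (h , h′)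
      ... | h , h′ | inj₁ refl | inj₂ refl = inj₂ (inj₁ (h , trans (sym opp-R) h′))
      ... | h , h′ | inj₂ refl | inj₁ refl = inj₂ (inj₂ (inj₁ (trans (sym opp-P) h , h′)))
      ... | h , h′ | inj₂ refl | inj₂ refl =
        inj₂ (inj₂ (inj₂ (trans (sym opp-Q) h , trans (sym opp-S) h′)))

    breakpoint-or-left-independent-step : ∀ {x₀ Y y} → x₀ ≺ Y → Y ≺ y → LeftIndependent Y →
      Σ (T n) (IsBreakpoint τ) ⊎ LeftIndependent y
    breakpoint-or-left-independent-step {x₀} {Y} {y} p q left
      with τ̂ x₀ Y y ≟ᴬᴮ τ̂ x₀ Y (partner y)
    ... | yes same = inj₁ (Y , breakpoint-intro (≺⇒bot⊏ {x = x₀} p) (≺⇒⊏top {y = y} q) left right)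
      where
      towards-y : ∀ {z} → Y ≺ z → τ̂ x₀ Y z ≡ τ̂ x₀ Y y
      towards-y {z} q′ with ≡⊎≡partner-above {x = Y} {y} {z} q (trans q′ (sym q))
      ... | inj₁ refl = refl
      ... | inj₂ refl = sym same
      right : RightIndependent Y
      right {x} {z} {z′} p′ q′ q″ = begin
        τ̂ x Y z    ≡⟨ left p′ p q′ ⟩
        τ̂ x₀ Y z   ≡⟨ towards-y q′ ⟩
        τ̂ x₀ Y y   ≡⟨ sym (towards-y q″) ⟩
        τ̂ x₀ Y z′  ≡⟨ left p p′ q″ ⟩
        τ̂ x Y z′   ∎
    ... | no differ = inj₂ λ p₁ p₁′ r → trans (via-Y p₁ r) (sym (via-Y p₁′ r))
      where
      via-Y : ∀ {x z} → x ≺ y → y ≺ z → τ̂ x y z ≡ τ̂ Y y z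
      via-Y {x} {z} p₁ r with ≡⊎≡partner-above {x = x₀} {Y} {x} p (suc-injective (trans (sym p₁) q))
      ... | inj₁ refl = refl
      ... | inj₂ refl with rank-three p q r
      ...   | inj₁ same  = ⊥-elim (differ same)
      ...   | inj₂ same′ = sym same′

    breakpoint-or-left-independent : ∀ k {y} → rank y ≡ suc k →
      Σ (T n) (IsBreakpoint τ) ⊎ LeftIndependent y
    breakpoint-or-left-independent zero    e = inj₂ (left-independent-rank-one e)
    breakpoint-or-left-independent (suc k) e with lower-cover e
    ... | Y , eY , Y≺y with lower-cover eY | breakpoint-or-left-independent k eY
    ... | _ , _ , x₀≺Y | inj₁ bp   = inj₁ bp
    ... | _ , _ , x₀≺Y | inj₂ left = breakpoint-or-left-independent-step x₀≺Y Y≺y left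

    breakpoint-below-top : ∀ {k y} → rank y ≡ suc k → y ≺ top → Σ (T n) (IsBreakpoint τ)
    breakpoint-below-top {k} {y} e y≺top with breakpoint-or-left-independent k e
    ... | inj₁ bp   = bp
    ... | inj₂ left = y , breakpoint-intro (subst (1 ≤_) (sym e) (s≤s z≤n))
                            (≺⇒⊏top {x = y} y≺top) left (right-independent-below-top y≺top)

    module _ (v : T n) where

      -- a record rather than the bare equation, so that u can be inferred from it
      record Below (L : ℕ) (u : T n) : Set where
        constructor below
        field rank-v : rank v ≡ L + rank u

      below-≺ : ∀ {L u y} → Below (suc L) u → u ≺ y → Below L y
      below-≺ {u = u} (below e) p = below (distance-≺ {u = u} e p)

      below-⊏ : ∀ {L u} → Below (suc L) u → u ⊏ v
      below-⊏ {u = u} (below e) = ⊏-from-distance {x = u} {v} e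

      ¬below-v : ∀ {L} → ¬ Below (suc L) v
      ¬below-v (below e) = m≢1+n+m _ e

      ≺-next-from-partner : ∀ {L y} (c : Chain (partner y) v) → Below (suc L) (partner y) → y ≺ next c
      ≺-next-from-partner {y = y} c d =
        ≺-respects-rankˡ {x = partner y} {y} {next c} (rank-partner y) (≺-next c (below-⊏ d))

      UniqueRisingAt : ℕ → Set
      UniqueRisingAt L = ∀ {u} → Below L u → UniqueRising τ u v

      RisingContinues : ℕ → Set
      RisingContinues L = ∀ {u x} (cu : Chain u v) (cx : Chain x v) → Below L u → u ≺ x →
        Rising τ cu → Rising τ cx → τ̂ u (next cu) (next cx) ≡ 𝐚

      unique-rising-at-1 : UniqueRisingAt 1
      unique-rising-at-1 (below e) = unique-rising-local 0 e (s≤s z≤n)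

      unique-rising-at-2 : UniqueRisingAt 2
      unique-rising-at-2 (below e) = unique-rising-local 1 e (s≤s (s≤s z≤n))

      rising-continues-at-2 : RisingContinues 2
      rising-continues-at-2 (done _) _ d _ _ _ = ⊥-elim (¬below-v d)
      rising-continues-at-2 {u} (step {y = y} p w) cx d ux ru _ = begin
        τ̂ u y (next cx)  ≡⟨ cong (τ̂ u y) (trans (next-of-cover cx (Below.rank-v (below-≺ d ux)))
                                                (sym (next-of-cover w (Below.rank-v (below-≺ d p))))) ⟩
        τ̂ u y (next w)   ≡⟨ rising-head p w (below-⊏ (below-≺ d p)) ru ⟩
        𝐚                ∎

      module _ (k : ℕ) (unique : UniqueRisingAt (2 + k)) (continues : RisingContinues (2 + k)) where

        agree-on-rising-successors : ∀ {u y x x′} (cx : Chain x v) (cx′ : Chain x′ v) →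
          Below (3 + k) u → u ≺ y → u ≺ x → u ≺ x′ → Rising τ cx → Rising τ cx′ →
          τ̂ u y (next cx) ≡ τ̂ u y (next cx′)
        agree-on-rising-successors (done _) _ d _ ux _ _ _ = ⊥-elim (¬below-v (below-≺ d ux))
        agree-on-rising-successors (step xz (done _)) _ d _ ux _ _ _ =
          ⊥-elim (¬below-v (below-≺ (below-≺ d ux) xz))
        agree-on-rising-successors (step _ (step _ _)) (done _) d _ _ ux′ _ _ =
          ⊥-elim (¬below-v (below-≺ d ux′))
        agree-on-rising-successors {u} {y} {x} {x′}
          (step {y = z} xz (step {y = c} zc cc)) (step {y = z′} x′z′ cx″) d uy ux ux′ rx rx′
          with ≡⊎≡partner-above {x = u} {x} {x′} ux (trans ux′ (sym ux))
             | ≡⊎≡partner-above {x = x} {z} {z′} xz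
                 (trans x′z′ (trans (cong suc (trans ux′ (sym ux))) (sym xz)))
        ... | _         | inj₁ refl = refl
        ... | inj₁ refl | inj₂ refl = ⊥-elim (partner-≢-between {x = x} {z} {c} xz zc
          (rising-next-unique (unique (below-≺ d ux)) (step x′z′ cx″) (step xz (step zc cc)) rx′ rx))
        ... | inj₂ refl | inj₂ refl with rank-three ux xz zc
        ...   | inj₂ same-after = ⊥-elim (𝐚≢𝐛 (begin
          𝐚                              ≡⟨ sym (continues (step x′z′ cx″) (step zc cc) (below-≺ d ux′)
                                                  (≺-partnerˡ {x = x} xz) rx′ (rising-tail xz _ rx)) ⟩
          τ̂ (partner x) (partner z) c    ≡⟨ τ̂-partner-middle (≺-partnerˡ {x = x} xz) zc ⟩
          opp (τ̂ (partner x) z c)        ≡⟨ cong opp (sym same-after) ⟩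
          opp (τ̂ x z c)                  ≡⟨ cong opp (rising-head xz (step zc cc)
                                                  (below-⊏ (below-≺ (below-≺ d ux) xz)) rx) ⟩
          𝐛                              ∎))
        ...   | inj₁ same-before with ≡⊎≡partner-above {x = u} {x} {y} ux (trans uy (sym ux))
        ...     | inj₁ refl = same-before
        ...     | inj₂ refl = begin
          τ̂ u (partner x) z              ≡⟨ τ̂-partner-middle ux xz ⟩
          opp (τ̂ u x z)                  ≡⟨ cong opp same-before ⟩
          opp (τ̂ u x (partner z))        ≡⟨ sym (τ̂-partner-middle ux (≺-partnerʳ {y = z} xz)) ⟩
          τ̂ u (partner x) (partner z)    ∎

        rising-unique-step : ∀ {u} → Below (3 + k) u →
          (c c′ : Chain u v) → Rising τ c → Rising τ c′ → c′ ≡ c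
        rising-unique-step d (done _)   _          _ _ = ⊥-elim (¬below-v d)
        rising-unique-step d (step _ _) (done _)   _ _ = ⊥-elim (¬below-v d)
        rising-unique-step {u} d (step {y = y} p w) (step {y = y′} p′ w′) r r′
          with ≡⊎≡partner-above {x = u} {y} {y′} p (trans p′ (sym p))
        ... | inj₁ refl = cong₂ step (≡-irrelevant p′ p)
          (rising-unique (unique (below-≺ d p)) w w′ (rising-tail p w r) (rising-tail p′ w′ r′))
        ... | inj₂ refl = ⊥-elim (𝐚≢𝐛 (begin
          𝐚                          ≡⟨ sym (rising-head p′ w′ (below-⊏ (below-≺ d p′)) r′) ⟩
          τ̂ u (partner y) (next w′)  ≡⟨ τ̂-partner-middle p (≺-next-from-partner w′ (below-≺ d p′)) ⟩
          opp (τ̂ u y (next w′))      ≡⟨ cong opp (sym (agree-on-rising-successors w w′ d p p p′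
                                                          (rising-tail p w r) (rising-tail p′ w′ r′))) ⟩
          opp (τ̂ u y (next w))       ≡⟨ cong opp (rising-head p w (below-⊏ (below-≺ d p)) r) ⟩
          𝐛                          ∎))

        rising-exists-step : ∀ {u} → Below (3 + k) u → Σ (Chain u v) (Rising τ)
        rising-exists-step {u} d with cover-of (≤-trans (below-⊏ d) (rank≤n v))
        ... | y , p with unique (below-≺ d p) | unique (below-≺ d (≺-partnerʳ {y = y} p))
        ... | c₀ , r₀ , _ | c₁ , r₁ , _ with τ̂ u y (next c₀) in first
        ... | 𝐚 = step p c₀ , rising-cons p c₀ (below-⊏ (below-≺ d p)) first r₀
        ... | 𝐛 = step p′ c₁ , rising-cons p′ c₁ (below-⊏ (below-≺ d p′)) partner-first r₁
          where
          p′ : u ≺ partner y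
          p′ = ≺-partnerʳ {y = y} p
          partner-first : τ̂ u (partner y) (next c₁) ≡ 𝐚
          partner-first = begin
            τ̂ u (partner y) (next c₁)  ≡⟨ τ̂-partner-middle p
                                              (≺-next-from-partner c₁ (below-≺ d p′)) ⟩
            opp (τ̂ u y (next c₁))      ≡⟨ cong opp (agree-on-rising-successors c₁ c₀ d p p′ p r₁ r₀) ⟩
            opp (τ̂ u y (next c₀))      ≡⟨ cong opp first ⟩
            𝐚                          ∎

        unique-rising-step : UniqueRisingAt (3 + k)
        unique-rising-step d with rising-exists-step d
        ... | c , r = c , r , λ c′ r′ → rising-unique-step d c c′ r r′

        rising-continues-step : RisingContinues (3 + k)
        rising-continues-step (done _)   _  d _  _  _  = ⊥-elim (¬below-v d)
        rising-continues-step (step p w) cx d ux ru rx =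
          trans (sym (agree-on-rising-successors w cx d p p ux (rising-tail p w ru) rx))
                (rising-head p w (below-⊏ (below-≺ d p)) ru)

      rising-invariant : ∀ k → UniqueRisingAt (2 + k) × RisingContinues (2 + k)
      rising-invariant zero    = unique-rising-at-2 , rising-continues-at-2
      rising-invariant (suc k) with rising-invariant k
      ... | unique , continues =
        unique-rising-step k unique continues , rising-continues-step k unique continues

      unique-rising-below : ∀ L → UniqueRisingAt (suc L)
      unique-rising-below zero    = unique-rising-at-1
      unique-rising-below (suc L) = proj₁ (rising-invariant L)

    triple-assignment : IsTripleAssignment τ
    triple-assignment x y x⊏y =
      unique-rising-below y (rank y ∸ suc (rank x)) (below (distance-from-⊏ {x = x} {y} x⊏y))

mainTheorem2 : (n : ℕ) → 2 ≤ n → (τ : Assignment n) →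
    ((x y : T n) → x ⊏ y → rank y ∸ rank x ≤ 3 → UniqueRising τ x y) →
    Σ (T n) (λ y → IsBreakpoint τ y) × IsTripleAssignment τ
mainTheorem2 (suc zero) (s≤s ()) _ _
mainTheorem2 (suc (suc m)) _ τ local with element-of-rank (suc m) (n≤1+n (suc m))
... | y , e = breakpoint-below-top τ local e (cong suc (sym e)) , triple-assignment τ local
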